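{- Let $n$ be a nonnegative integer. (a) The number of even-zeroed paths of length $4n$ equals $\sum_{i+j=n,\ i,j\ge0} C_{2i}B_{2j}$. (b) The number of even-zeroed paths of length $4n+1$ ending at the point $(4n+1,1)$ equals $\sum_{i+j=n,\ i,j\ge0} C_{2i}C_{2j}$.
   Context: A path of length $l$ is a sequence of $l$ steps, each an up-step $(1,1)$ or a down-step $(1,-1)$, drawn in the plane starting at the origin (no balance condition is imposed). The $x$-intercepts of a path are the $x$-coordinates $k\in\{0,1,\dots,l\}$ of the lattice points $(k,0)$ visited by the path (this includes $k=0$). A path is called even-zeroed if all of its $x$-intercepts are divisible by $4$. For a nonnegative integer $m$, $C_m=\frac{1}{m+1}\binom{2m}{m}$ and $B_m=\binom{2m}{m}$. -}

module Defs where

open import Data.Bool using (Bool; true; false)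
open import Data.Nat using (ℕ; zero; suc; _+_; _*_; _∸_)
open import Data.Nat.Combinatorics using (_C_)
open import Data.Nat.Divisibility using (_∣_; _∣?_)
open import Data.Integer as ℤ using (ℤ; +_)
open import Data.List using (List; []; _∷_; map; length; filter; take; upTo)
open import Data.Nat.ListAction using (sum)
open import Relation.Binary.PropositionalEquality using (_≡_)
open import Relation.Nullary using (Dec; yes; no; ¬_)
open import Relation.Nullary.Decidable using (_→-dec_)

-- A path is a list of steps: true = up-step (1,1), false = down-step (1,-1).
Path : Set
Path = List Bool

step : Bool → ℤ
step true  = + 1
step false = ℤ.- (+ 1)

height : Path → ℤ
height []       = + 0
height (s ∷ p) = step s ℤ.+ height p

allPaths : ℕ → List Path
allPaths zero    = [] ∷ []
allPaths (suc l) = map (true ∷_) (allPaths l) Data.List.++ map (false ∷_) (allPaths l)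

-- k is an x-intercept of p : 0 ≤ k ≤ length p and the prefix of length k ends at height 0
-- Even-zeroed: every x-intercept is divisible by 4.
-- We quantify over k ∈ {0,…,length p} via the list upTo (suc (length p)).
open import Data.List.Relation.Unary.All using (All; all?)

EvenZeroed : Path → Set
EvenZeroed p = All (λ k → height (take k p) ≡ + 0 → 4 ∣ k) (upTo (suc (length p)))

evenZeroed? : (p : Path) → Dec (EvenZeroed p)
evenZeroed? p = all? (λ k → (height (take k p) ℤ.≟ + 0) →-dec (4 ∣? k)) (upTo (suc (length p)))

countEZ : ℕ → ℕ
countEZ l = length (filter evenZeroed? (allPaths l))

EndsAt1 : Path → Set
EndsAt1 p = height p ≡ + 1

countEZ1 : ℕ → ℕ
countEZ1 l = length (filter (λ p → Relation.Nullary.Decidable._×-dec_ (evenZeroed? p) (height p ℤ.≟ + 1)) (allPaths l))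

Cat : ℕ → ℕ
Cat m = ((2 * m) C m) Data.Nat./ suc m

Bin : ℕ → ℕ
Bin m = (2 * m) C m

convSum : (ℕ → ℕ → ℕ) → ℕ → ℕ
convSum f n = sum (map (λ i → f i (n ∸ i)) (upTo (suc n)))

module Submission where

-- Only the visits to the axis are constrained, so heights are measured as distances from it
-- (the factor 2 in part (b) is the reflection exchanging the end heights 1 and −1). Cutting a
-- path at its first return to the axis, which for an even-zeroed path happens at a time 4i, gives
-- the renewal equation a = T + F ⋆ a for the number a n of even-zeroed paths of length 4n: F i
-- counts first returns at time 4i and T n = B_{2n} counts the paths of length 4n that never
-- return. Splitting the Catalan recurrence by parity shows that c n = C_{2n} satisfies
-- c = δ + F ⋆ c, and as F 0 = 0 the renewal equation has only one solution, so a = c ⋆ T.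
-- Likewise twice the count in (b) satisfies b = 2 c + F ⋆ b, whence b = 2 (c ⋆ c).

open import Defs
open import Data.Nat using (ℕ; _+_; _*_)
open import Data.Product using (_×_)
open import Relation.Binary.PropositionalEquality using (_≡_)

open import Data.Bool using (Bool; true; false; _∧_)
open import Data.Integer as ℤ using (ℤ; +0; +[1+_]; -[1+_]; ∣_∣)
import Data.Integer.Properties as ℤ
open import Data.List using ([]; _∷_; map; _++_; length; filter; take; applyUpTo)
open import Data.List.Properties using (map-++; map-∘; map-cong; map-applyUpTo)
open import Data.List.Relation.Unary.All.Properties using (applyUpTo⁺₁; applyUpTo⁻)
open import Data.Nat using (zero; suc; _∸_; _/_; _≤_; _<_; z≤n; s≤s)
open import Data.Nat.Combinatorics using (_C_; nCk≡nC[n∸k]; nCk+nC[k+1]≡[n+1]C[k+1])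
open import Data.Nat.Divisibility using (_∣_; divides; ∣-refl; ∣m∣n⇒∣m+n; ∣m+n∣m⇒∣n; ∣⇒≤)
open import Data.Nat.DivMod using (m*n/n≡m)
open import Data.Nat.Induction using (<-rec)
open import Data.Nat.ListAction using (sum)
open import Data.Nat.ListAction.Properties using (sum-++)
open import Data.Nat.Properties
open import Algebra.Properties.CommutativeSemigroup +-commutativeSemigroup using (interchange; x∙yz≈y∙xz)
import Algebra.Properties.CommutativeSemigroup *-commutativeSemigroup as *
open import Data.Product using (_,_)
open import Function using (id)
open import Relation.Binary.PropositionalEquality using (refl; sym; trans; cong; cong₂; subst; module ≡-Reasoning)
open import Relation.Nullary using (does; contradiction)
open import Relation.Nullary.Decidable using (dec-true; dec-false)
open import Relation.Unary using (Decidable)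

open ≡-Reasoning

-- Sums over antidiagonals and convolution

-- diagSum n F = ∑_{k + j = n} F k j
diagSum : ℕ → (ℕ → ℕ → ℕ) → ℕ
diagSum zero    F = F 0 0
diagSum (suc n) F = F 0 (suc n) + diagSum n (λ k j → F (suc k) j)

diagSum-cong-antidiagonal : ∀ n {F G : ℕ → ℕ → ℕ} →
  (∀ k j → k + j ≡ n → F k j ≡ G k j) → diagSum n F ≡ diagSum n G
diagSum-cong-antidiagonal zero    eq = eq 0 0 refl
diagSum-cong-antidiagonal (suc n) eq =
  cong₂ _+_ (eq 0 (suc n) refl) (diagSum-cong-antidiagonal n (λ k j e → eq (suc k) j (cong suc e)))

diagSum-cong : ∀ n {F G : ℕ → ℕ → ℕ} → (∀ k j → F k j ≡ G k j) → diagSum n F ≡ diagSum n G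
diagSum-cong n eq = diagSum-cong-antidiagonal n (λ k j _ → eq k j)

diagSum-0 : ∀ n → diagSum n (λ _ _ → 0) ≡ 0
diagSum-0 zero    = refl
diagSum-0 (suc n) = diagSum-0 n

diagSum-+ : ∀ n F G → diagSum n (λ k j → F k j + G k j) ≡ diagSum n F + diagSum n G
diagSum-+ zero    F G = refl
diagSum-+ (suc n) F G = begin
  F 0 (suc n) + G 0 (suc n) + diagSum n (λ k j → F (suc k) j + G (suc k) j)
    ≡⟨ cong (F 0 (suc n) + G 0 (suc n) +_) (diagSum-+ n _ _) ⟩
  F 0 (suc n) + G 0 (suc n) + (diagSum n _ + diagSum n _)
    ≡⟨ interchange (F 0 (suc n)) (G 0 (suc n)) _ _ ⟩
  diagSum (suc n) F + diagSum (suc n) G ∎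

diagSum-*ˡ : ∀ n c F → diagSum n (λ k j → c * F k j) ≡ c * diagSum n F
diagSum-*ˡ zero    c F = refl
diagSum-*ˡ (suc n) c F =
  trans (cong (c * F 0 (suc n) +_) (diagSum-*ˡ n c _)) (sym (*-distribˡ-+ c _ _))

diagSum-last : ∀ n F → diagSum (suc n) F ≡ diagSum n (λ k j → F k (suc j)) + F (suc n) 0
diagSum-last zero    F = refl
diagSum-last (suc n) F =
  trans (cong (F 0 (2 + n) +_) (diagSum-last n (λ k j → F (suc k) j)))
        (sym (+-assoc (F 0 (2 + n)) _ _))

diagSum-swap : ∀ n F → diagSum n F ≡ diagSum n (λ k j → F j k)
diagSum-swap zero    F = refl
diagSum-swap (suc n) F = begin
  F 0 (suc n) + diagSum n (λ k j → F (suc k) j)  ≡⟨ cong (F 0 (suc n) +_) (diagSum-swap n _) ⟩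
  F 0 (suc n) + diagSum n (λ k j → F (suc j) k)  ≡⟨ +-comm (F 0 (suc n)) _ ⟩
  diagSum n (λ k j → F (suc j) k) + F 0 (suc n)  ≡⟨ diagSum-last n (λ k j → F j k) ⟨
  diagSum (suc n) (λ k j → F j k)                ∎

convSum≡diagSum : ∀ (F : ℕ → ℕ → ℕ) n → convSum F n ≡ diagSum n F
convSum≡diagSum F n = trans (cong sum (map-applyUpTo id (λ i → F i (n ∸ i)) (suc n))) (go n F)
  where
  go : ∀ n (F : ℕ → ℕ → ℕ) → sum (applyUpTo (λ i → F i (n ∸ i)) (suc n)) ≡ diagSum n F
  go zero    F = +-identityʳ _
  go (suc n) F = cong (F 0 (suc n) +_) (go n (λ k j → F (suc k) j))

double : ℕ → ℕ
double zero    = zero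
double (suc n) = suc (suc (double n))

quadruple : ℕ → ℕ
quadruple n = double (double n)

double≡2* : ∀ n → double n ≡ 2 * n
double≡2* zero    = refl
double≡2* (suc n) = trans (cong (2 +_) (double≡2* n)) (sym (*-distribˡ-+ 2 1 n))

quadruple≡4* : ∀ n → quadruple n ≡ 4 * n
quadruple≡4* n = begin
  double (double n)  ≡⟨ double≡2* (double n) ⟩
  2 * double n       ≡⟨ cong (2 *_) (double≡2* n) ⟩
  2 * (2 * n)        ≡⟨ *-assoc 2 2 n ⟨
  4 * n              ∎

diagSum-double : ∀ n F → (∀ k j → F (suc (double k)) j ≡ 0) →
  diagSum (double n) F ≡ diagSum n (λ k j → F (double k) (double j))
diagSum-double zero    F odd≡0 = refl
diagSum-double (suc n) F odd≡0 = cong (F 0 (double (suc n)) +_) (begin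
  F 1 (suc (double n)) + diagSum (double n) F₂
    ≡⟨ cong (_+ diagSum (double n) F₂) (odd≡0 0 (suc (double n))) ⟩
  diagSum (double n) F₂
    ≡⟨ diagSum-double n F₂ (λ k j → odd≡0 (suc k) j) ⟩
  diagSum n (λ k j → F (double (suc k)) (double j)) ∎)
  where
  F₂ : ℕ → ℕ → ℕ
  F₂ k j = F (2 + k) j

diagSum-suc-double : ∀ n F → diagSum (suc (double n)) F ≡
  diagSum n (λ k j → F (double k) (suc (double j)))
    + diagSum n (λ k j → F (suc (double k)) (double j))
diagSum-suc-double zero    F = refl
diagSum-suc-double (suc n) F = begin
  a + (b + diagSum (suc (double n)) F₂)  ≡⟨ cong (λ s → a + (b + s)) (diagSum-suc-double n F₂) ⟩
  a + (b + (x + y))                     ≡⟨ cong (a +_) (x∙yz≈y∙xz b x y) ⟩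
  a + (x + (b + y))                     ≡⟨ +-assoc a x (b + y) ⟨
  a + x + (b + y)                       ∎
  where
  F₂ : ℕ → ℕ → ℕ
  F₂ k j = F (2 + k) j
  a = F 0 (3 + double n)
  b = F 1 (2 + double n)
  x = diagSum n (λ k j → F₂ (double k) (suc (double j)))
  y = diagSum n (λ k j → F₂ (suc (double k)) (double j))

infixl 7 _⋆_

_⋆_ : (ℕ → ℕ) → (ℕ → ℕ) → ℕ → ℕ
(f ⋆ g) n = diagSum n (λ k j → f k * g j)

δ : ℕ → ℕ
δ zero    = 1
δ (suc n) = 0

⋆-cong : ∀ n {f f′ g g′ : ℕ → ℕ} →
  (∀ m → f m ≡ f′ m) → (∀ m → g m ≡ g′ m) → (f ⋆ g) n ≡ (f′ ⋆ g′) n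
⋆-cong n f≗f′ g≗g′ = diagSum-cong n (λ k j → cong₂ _*_ (f≗f′ k) (g≗g′ j))

δ-⋆ : ∀ n g → (δ ⋆ g) n ≡ g n
δ-⋆ zero    g = +-identityʳ (g 0)
δ-⋆ (suc n) g = trans (cong₂ _+_ (+-identityʳ (g (suc n))) (diagSum-0 n)) (+-identityʳ _)

⋆-distribʳ-+ : ∀ n f g h → ((λ m → f m + g m) ⋆ h) n ≡ (f ⋆ h) n + (g ⋆ h) n
⋆-distribʳ-+ n f g h = trans (diagSum-cong n (λ k j → *-distribʳ-+ (h j) (f k) (g k))) (diagSum-+ n _ _)

⋆-*ˡ : ∀ n a f g → ((λ m → a * f m) ⋆ g) n ≡ a * (f ⋆ g) n
⋆-*ˡ n a f g = trans (diagSum-cong n (λ k j → *-assoc a (f k) (g j))) (diagSum-*ˡ n a _)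

⋆-*ʳ : ∀ n a f g → (f ⋆ (λ m → a * g m)) n ≡ a * (f ⋆ g) n
⋆-*ʳ n a f g = trans (diagSum-cong n (λ k j → *.x∙yz≈y∙xz (f k) a (g j))) (diagSum-*ˡ n a _)

⋆-assoc : ∀ n f g h → ((f ⋆ g) ⋆ h) n ≡ (f ⋆ (g ⋆ h)) n
⋆-assoc zero    f g h = *-assoc (f 0) (g 0) (h 0)
⋆-assoc (suc n) f g h = begin
  f 0 * g 0 * h (suc n) + ((λ m → f 0 * g (suc m) + (f′ ⋆ g) m) ⋆ h) n
    ≡⟨ cong (f 0 * g 0 * h (suc n) +_) (⋆-distribʳ-+ n (λ m → f 0 * g′ m) (f′ ⋆ g) h) ⟩
  f 0 * g 0 * h (suc n) + (((λ m → f 0 * g′ m) ⋆ h) n + ((f′ ⋆ g) ⋆ h) n)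
    ≡⟨ cong₂ (λ p q → f 0 * g 0 * h (suc n) + (p + q)) (⋆-*ˡ n (f 0) g′ h) (⋆-assoc n f′ g h) ⟩
  f 0 * g 0 * h (suc n) + (f 0 * (g′ ⋆ h) n + (f′ ⋆ (g ⋆ h)) n)
    ≡⟨ regroup (f 0) (g 0) (h (suc n)) ((g′ ⋆ h) n) ((f′ ⋆ (g ⋆ h)) n) ⟩
  f 0 * (g 0 * h (suc n) + (g′ ⋆ h) n) + (f′ ⋆ (g ⋆ h)) n ∎
  where
  f′ g′ : ℕ → ℕ
  f′ m = f (suc m)
  g′ m = g (suc m)
  regroup : ∀ a b x y z → a * b * x + (a * y + z) ≡ a * (b * x + y) + z
  regroup a b x y z = begin
    a * b * x + (a * y + z)  ≡⟨ +-assoc (a * b * x) (a * y) z ⟨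
    a * b * x + a * y + z    ≡⟨ cong (λ p → p + a * y + z) (*-assoc a b x) ⟩
    a * (b * x) + a * y + z  ≡⟨ cong (_+ z) (*-distribˡ-+ a (b * x) y) ⟨
    a * (b * x + y) + z      ∎

renewal-solution : ∀ (F T Z : ℕ → ℕ) → (∀ n → Z n ≡ δ n + (F ⋆ Z) n) →
  ∀ n → (Z ⋆ T) n ≡ T n + (F ⋆ (Z ⋆ T)) n
renewal-solution F T Z Z-renewal n = begin
  (Z ⋆ T) n                            ≡⟨ ⋆-cong n Z-renewal (λ _ → refl) ⟩
  ((λ m → δ m + (F ⋆ Z) m) ⋆ T) n      ≡⟨ ⋆-distribʳ-+ n δ (F ⋆ Z) T ⟩
  (δ ⋆ T) n + ((F ⋆ Z) ⋆ T) n          ≡⟨ cong₂ _+_ (δ-⋆ n T) (⋆-assoc n F Z T) ⟩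
  T n + (F ⋆ (Z ⋆ T)) n                ∎

renewal-unique : ∀ (F T : ℕ → ℕ) {x y : ℕ → ℕ} → F 0 ≡ 0 →
  (∀ n → x n ≡ T n + (F ⋆ x) n) → (∀ n → y n ≡ T n + (F ⋆ y) n) → ∀ n → x n ≡ y n
renewal-unique F T {x} {y} F0≡0 x-renewal y-renewal = <-rec (λ n → x n ≡ y n) agree
  where
  agree : ∀ n → (∀ {m} → m < n → x m ≡ y m) → x n ≡ y n
  agree n below = begin
    x n              ≡⟨ x-renewal n ⟩
    T n + (F ⋆ x) n  ≡⟨ cong (T n +_) (diagSum-cong-antidiagonal n same-terms) ⟩
    T n + (F ⋆ y) n  ≡⟨ y-renewal n ⟨
    y n              ∎
    where
    same-terms : ∀ k j → k + j ≡ n → F k * x j ≡ F k * y j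
    same-terms zero    j _ rewrite F0≡0 = refl
    same-terms (suc k) j k+j≡n =
      cong (F (suc k) *_) (below (subst (j <_) k+j≡n (s≤s (m≤n+m j k))))

-- Binomial coefficients

binom : ℕ → ℕ → ℕ
binom n       zero    = 1
binom zero    (suc k) = 0
binom (suc n) (suc k) = binom n k + binom n (suc k)

binom↓ : ℕ → ℕ → ℕ
binom↓ n zero    = 0
binom↓ n (suc u) = binom n u

binom-suc : ∀ n u → binom (suc n) u ≡ binom↓ n u + binom n u
binom-suc n zero    = refl
binom-suc n (suc u) = refl

binom≡C : ∀ n k → binom n k ≡ n C k
binom≡C n       zero    = refl
binom≡C zero    (suc k) = refl
binom≡C (suc n) (suc k) =
  trans (cong₂ _+_ (binom≡C n k) (binom≡C n (suc k))) (nCk+nC[k+1]≡[n+1]C[k+1] n k)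

binom-1 : ∀ n → binom n 1 ≡ n
binom-1 zero    = refl
binom-1 (suc n) = cong suc (binom-1 n)

binom-sym : ∀ a b → binom (a + b) b ≡ binom (a + b) a
binom-sym a b = begin
  binom (a + b) b          ≡⟨ binom≡C (a + b) b ⟩
  (a + b) C b              ≡⟨ nCk≡nC[n∸k] (m≤n+m b a) ⟩
  (a + b) C (a + b ∸ b)    ≡⟨ cong ((a + b) C_) (m+n∸n≡m a b) ⟩
  (a + b) C a              ≡⟨ binom≡C (a + b) a ⟨
  binom (a + b) a          ∎

double≡+ : ∀ n → double n ≡ n + n
double≡+ n = trans (double≡2* n) (cong (n +_) (+-identityʳ n))

binom-sym-double : ∀ a j → binom (a + double j) j ≡ binom (a + double j) (a + j)
binom-sym-double a j =
  subst (λ n → binom n j ≡ binom n (a + j)) a+j+j≡a+double (binom-sym (a + j) j)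
  where
  a+j+j≡a+double : a + j + j ≡ a + double j
  a+j+j≡a+double = trans (+-assoc a j j) (cong (a +_) (sym (double≡+ j)))

binom-absorb : ∀ n k → suc k * binom (suc n) (suc k) ≡ suc n * binom n k
binom-absorb n       zero    =
  trans (*-identityˡ _) (trans (binom-1 (suc n)) (sym (*-identityʳ (suc n))))
binom-absorb zero    (suc k) = *-zeroʳ (2 + k)
binom-absorb (suc n) (suc k) = begin
  (2 + k) * (x + y + z)             ≡⟨ *-distribˡ-+ (2 + k) (x + y) z ⟩
  (x + y) + (1 + k) * (x + y) + (2 + k) * z
            ≡⟨ cong₂ (λ p q → (x + y) + p + q) (binom-absorb n k) (binom-absorb n (suc k)) ⟩
  (x + y) + (1 + n) * x + (1 + n) * y
                                    ≡⟨ +-assoc (x + y) _ _ ⟩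
  (x + y) + ((1 + n) * x + (1 + n) * y)
                                    ≡⟨ cong ((x + y) +_) (*-distribˡ-+ (1 + n) x y) ⟨
  (2 + n) * (x + y)                 ∎
  where
  x = binom n k
  y = binom n (suc k)
  z = binom (suc n) (2 + k)

/-exact : ∀ m c b → suc m * c ≡ b → b / suc m ≡ c
/-exact m c b m*c≡b =
  trans (cong (_/ suc m) (trans (sym m*c≡b) (*-comm (suc m) c))) (m*n/n≡m c (suc m))

-- Paths that avoid the axis

-- Heights are natural numbers here. avoiding u l d sums the weight u of the end height over
-- the paths of length l from height d that never touch 0; firstHit k d counts the paths from
-- height d that touch 0 for the first time after k steps.
avoiding : (ℕ → ℕ) → ℕ → ℕ → ℕ
avoiding u zero    zero    = 0
avoiding u zero    (suc d) = u (suc d)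
avoiding u (suc l) zero    = 0
avoiding u (suc l) (suc d) = avoiding u l (2 + d) + avoiding u l d

firstHit : ℕ → ℕ → ℕ
firstHit zero    zero    = 1
firstHit zero    (suc d) = 0
firstHit (suc k) zero    = 0
firstHit (suc k) (suc d) = firstHit k (2 + d) + firstHit k d

atOne : ℕ → ℕ
atOne (suc zero) = 1
atOne _          = 0

dyck : ℕ → ℕ
dyck l = avoiding atOne l 1

escape : ℕ → ℕ
escape l = avoiding (λ _ → 1) l 1

avoiding-0 : ∀ u l → avoiding u l 0 ≡ 0
avoiding-0 u zero    = refl
avoiding-0 u (suc l) = refl

firstHit-suc : ∀ k d → firstHit (suc k) d ≡ avoiding atOne k d
firstHit-suc k       zero          = sym (avoiding-0 atOne k)
firstHit-suc zero    (suc zero)    = refl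
firstHit-suc zero    (suc (suc d)) = refl
firstHit-suc (suc k) (suc d)       = cong₂ _+_ (firstHit-suc k (2 + d)) (firstHit-suc k d)

avoiding-atOne-firstHit : ∀ l d →
  avoiding atOne l (suc d) ≡ diagSum l (λ k j → firstHit k d * dyck j)
avoiding-atOne-firstHit zero    zero    = refl
avoiding-atOne-firstHit (suc l) zero    =
  sym (trans (cong₂ _+_ (*-identityˡ (dyck (suc l))) (diagSum-0 l)) (+-identityʳ _))
avoiding-atOne-firstHit zero    (suc d) = refl
avoiding-atOne-firstHit (suc l) (suc d) = begin
  avoiding atOne l (3 + d) + avoiding atOne l (suc d)
    ≡⟨ cong₂ _+_ (avoiding-atOne-firstHit l (2 + d)) (avoiding-atOne-firstHit l d) ⟩
  diagSum l (λ k j → firstHit k (2 + d) * dyck j) + diagSum l (λ k j → firstHit k d * dyck j)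
    ≡⟨ diagSum-+ l _ _ ⟨
  diagSum l (λ k j → firstHit k (2 + d) * dyck j + firstHit k d * dyck j)
    ≡⟨ diagSum-cong l (λ k j → *-distribʳ-+ (dyck j) (firstHit k (2 + d)) (firstHit k d)) ⟨
  diagSum l (λ k j → firstHit (suc k) (suc d) * dyck j) ∎

dyck-suc-suc : ∀ m → dyck (2 + m) ≡ (dyck ⋆ dyck) m
dyck-suc-suc m = begin
  avoiding atOne (suc m) 2 + 0                 ≡⟨ +-identityʳ _ ⟩
  avoiding atOne (suc m) 2                     ≡⟨ avoiding-atOne-firstHit (suc m) 1 ⟩
  diagSum m (λ k j → firstHit (suc k) 1 * dyck j)
                                               ≡⟨ diagSum-cong m (λ k j → cong (_* dyck j) (firstHit-suc k 1)) ⟩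
  (dyck ⋆ dyck) m                              ∎

avoiding-atOne-parity : ∀ l d m → l + d ≡ double m → avoiding atOne l d ≡ 0
avoiding-atOne-parity zero    zero          m       _  = refl
avoiding-atOne-parity zero    (suc zero)    zero    ()
avoiding-atOne-parity zero    (suc zero)    (suc m) ()
avoiding-atOne-parity zero    (suc (suc d)) m       _  = refl
avoiding-atOne-parity (suc l) zero          m       _  = refl
avoiding-atOne-parity (suc l) (suc d)       zero    ()
avoiding-atOne-parity (suc l) (suc d)       (suc m) eq =
  cong₂ _+_ (avoiding-atOne-parity l (2 + d) (suc m) (trans (+-suc l (suc d)) (cong suc odd)))
            (avoiding-atOne-parity l d m (suc-injective (trans (sym (+-suc l d)) odd)))
  where
  odd : l + suc d ≡ suc (double m)
  odd = suc-injective eq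

dyck-odd : ∀ j → dyck (suc (double j)) ≡ 0
dyck-odd j = avoiding-atOne-parity (suc (double j)) 1 (suc j) (cong suc (+-comm (double j) 1))

avoiding-atOne-far : ∀ l k → avoiding atOne l (2 + (l + k)) ≡ 0
avoiding-atOne-far zero    zero    = refl
avoiding-atOne-far zero    (suc k) = refl
avoiding-atOne-far (suc l) k       = cong₂ _+_
  (trans (cong (λ h → avoiding atOne l (2 + h)) (sym (trans (+-suc l (suc k)) (cong suc (+-suc l k)))))
         (avoiding-atOne-far l (2 + k)))
  (avoiding-atOne-far l k)

avoiding-atOne-diagonal : ∀ e → avoiding atOne e (suc e) ≡ 1
avoiding-atOne-diagonal zero    = refl
avoiding-atOne-diagonal (suc e) = cong₂ _+_
  (trans (cong (λ h → avoiding atOne e (2 + h)) (+-comm 1 e)) (avoiding-atOne-far e 1))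
  (avoiding-atOne-diagonal e)

-- The positive paths from height e + 1 to height 1 with n = 2u + e steps, u of them up-steps,
-- number binom n u − binom n (u − 1).
ballot : ∀ u e n → double u + e ≡ n → avoiding atOne n (suc e) + binom↓ n u ≡ binom n u
ballot zero    e       .e refl = trans (+-identityʳ _) (avoiding-atOne-diagonal e)
ballot (suc v) zero    .(2 + (double v + 0)) refl = begin
  avoiding atOne L 2 + 0 + binom (suc L) v
    ≡⟨ cong₂ _+_ (+-identityʳ _) (binom-suc L v) ⟩
  avoiding atOne L 2 + (binom↓ L v + binom L v)
    ≡⟨ +-assoc (avoiding atOne L 2) _ _ ⟨
  avoiding atOne L 2 + binom↓ L v + binom L v
    ≡⟨ cong (_+ binom L v) (ballot v 1 L (trans (+-comm (double v) 1) (cong suc (sym (+-identityʳ _))))) ⟩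
  binom L v + binom L v
    ≡⟨ cong (binom L v +_) (subst (λ n → binom (suc n) v ≡ binom (suc n) (suc v))
                                  (sym (+-identityʳ (double v))) (binom-sym-double 1 v)) ⟩
  binom L v + binom L (suc v) ∎
  where L = suc (double v + 0)
ballot (suc v) (suc e) .(2 + (double v + suc e)) refl = begin
  avoiding atOne L (3 + e) + avoiding atOne L (suc e) + binom (suc L) v
    ≡⟨ cong (avoiding atOne L (3 + e) + avoiding atOne L (suc e) +_) (binom-suc L v) ⟩
  avoiding atOne L (3 + e) + avoiding atOne L (suc e) + (binom↓ L v + binom L v)
    ≡⟨ interchange (avoiding atOne L (3 + e)) _ _ _ ⟩
  (avoiding atOne L (3 + e) + binom↓ L v) + (avoiding atOne L (suc e) + binom L v)
    ≡⟨ cong₂ _+_ (ballot v (2 + e) L (+-suc (double v) (suc e)))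
                 (ballot (suc v) e L (cong suc (sym (+-suc (double v) e)))) ⟩
  binom L v + binom L (suc v) ∎
  where L = suc (double v + suc e)

dyck-double-ballot : ∀ m → dyck (double m) + binom↓ (double m) m ≡ binom (double m) m
dyck-double-ballot m = ballot m 0 (double m) (+-identityʳ (double m))

-- Add (m + 1) binom 2m (m − 1) = m binom 2m m to the ballot identity for m = j + 1.
dyck-double : ∀ m → suc m * dyck (double m) ≡ binom (double m) m
dyck-double zero    = refl
dyck-double (suc j) = +-cancelʳ-≡ (suc j * P) (suc (suc j) * dyck (double (suc j))) P (begin
  (2 + j) * dyck (double (suc j)) + (1 + j) * P ≡⟨ cong ((2 + j) * dyck (double (suc j)) +_) [2+j]Q≡[1+j]P ⟨
  (2 + j) * dyck (double (suc j)) + (2 + j) * Q ≡⟨ *-distribˡ-+ (2 + j) (dyck (double (suc j))) Q ⟨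
  (2 + j) * (dyck (double (suc j)) + Q)         ≡⟨ cong ((2 + j) *_) dyck+[2+j]Q≡[1+j]P ⟩
  (2 + j) * P                                   ∎)
  where
  n = suc (double j)
  P = binom (suc n) (suc j)
  Q = binom (suc n) j
  dyck+[2+j]Q≡[1+j]P : dyck (double (suc j)) + Q ≡ P
  dyck+[2+j]Q≡[1+j]P = dyck-double-ballot (suc j)
  [2+j]Q≡[1+j]P : (2 + j) * Q ≡ (1 + j) * P
  [2+j]Q≡[1+j]P = begin
    (2 + j) * Q                    ≡⟨ cong ((2 + j) *_) (binom-sym-double 2 j) ⟩
    (2 + j) * binom (suc n) (2 + j) ≡⟨ binom-absorb n (suc j) ⟩
    suc n * binom n (suc j)        ≡⟨ cong (suc n *_) (binom-sym-double 1 j) ⟨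
    suc n * binom n j              ≡⟨ binom-absorb n j ⟨
    (1 + j) * P                    ∎

Cat≡dyck : ∀ m → Cat m ≡ dyck (double m)
Cat≡dyck m = /-exact m (dyck (double m)) (2 * m C m) (begin
  suc m * dyck (double m)  ≡⟨ dyck-double m ⟩
  binom (double m) m       ≡⟨ binom≡C (double m) m ⟩
  double m C m             ≡⟨ cong (_C m) (double≡2* m) ⟩
  2 * m C m                ∎)

-- Each positive path extends in two ways, except that those ending at height 1 cannot step down.
avoiding-1-suc : ∀ l d → avoiding (λ _ → 1) (suc l) d + avoiding atOne l d ≡
                       avoiding (λ _ → 1) l d + avoiding (λ _ → 1) l d
avoiding-1-suc zero    zero          = refl
avoiding-1-suc zero    (suc zero)    = refl
avoiding-1-suc zero    (suc (suc d)) = refl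
avoiding-1-suc (suc l) zero          = refl
avoiding-1-suc (suc l) (suc d)       = begin
  (E′ (2 + d) + E′ d) + (A (2 + d) + A d)  ≡⟨ interchange (E′ (2 + d)) (E′ d) (A (2 + d)) (A d) ⟩
  (E′ (2 + d) + A (2 + d)) + (E′ d + A d)  ≡⟨ cong₂ _+_ (avoiding-1-suc l (2 + d)) (avoiding-1-suc l d) ⟩
  (E (2 + d) + E (2 + d)) + (E d + E d)    ≡⟨ interchange (E (2 + d)) (E (2 + d)) (E d) (E d) ⟩
  (E (2 + d) + E d) + (E (2 + d) + E d)    ∎
  where
  E E′ A : ℕ → ℕ
  E  = avoiding (λ _ → 1) l
  E′ = avoiding (λ _ → 1) (suc l)
  A  = avoiding atOne l

escape-double     : ∀ j → escape (double j) ≡ binom (double j) j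
escape-suc-double : ∀ j → escape (suc (double j)) ≡ binom (suc (double j)) j

escape-double zero    = refl
escape-double (suc j) = begin
  escape (2 + double j)                              ≡⟨ +-identityʳ _ ⟨
  escape (2 + double j) + 0                          ≡⟨ cong (escape (2 + double j) +_) (dyck-odd j) ⟨
  escape (2 + double j) + dyck (suc (double j))      ≡⟨ avoiding-1-suc (suc (double j)) 1 ⟩
  escape (suc (double j)) + escape (suc (double j))
    ≡⟨ cong₂ _+_ (escape-suc-double j) (trans (escape-suc-double j) (binom-sym-double 1 j)) ⟩
  binom (suc (double j)) j + binom (suc (double j)) (suc j) ∎

escape-suc-double j = +-cancelʳ-≡ (dyck (double j)) _ _ (begin
  escape (suc (double j)) + dyck (double j)       ≡⟨ avoiding-1-suc (double j) 1 ⟩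
  escape (double j) + escape (double j)           ≡⟨ cong₂ _+_ (trans (escape-double j) (sym (dyck-double-ballot j)))
                                                               (escape-double j) ⟩
  dyck (double j) + binom↓ (double j) j + binom (double j) j
                                                  ≡⟨ +-assoc (dyck (double j)) _ _ ⟩
  dyck (double j) + (binom↓ (double j) j + binom (double j) j)
                                                  ≡⟨ +-comm (dyck (double j)) _ ⟩
  (binom↓ (double j) j + binom (double j) j) + dyck (double j)
                                                  ≡⟨ cong (_+ dyck (double j)) (binom-suc (double j) j) ⟨
  binom (suc (double j)) j + dyck (double j)      ∎)

-- Paths whose zeros fall at multiples of 4

multipleOf4 : ℕ → Bool
multipleOf4 zero                      = true
multipleOf4 (suc zero)                = false
multipleOf4 (suc (suc zero))          = false
multipleOf4 (suc (suc (suc zero)))    = false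
multipleOf4 (suc (suc (suc (suc t)))) = multipleOf4 t

indicator : Bool → ℕ
indicator true  = 1
indicator false = 0

multipleOf4-suc-quadruple : ∀ i → multipleOf4 (suc (quadruple i)) ≡ false
multipleOf4-suc-quadruple zero    = refl
multipleOf4-suc-quadruple (suc i) = multipleOf4-suc-quadruple i

-- ezWalks u l t d: paths of length l started at time t at distance d from the axis, which
-- meet the axis only at times divisible by 4, weighted by u of their final distance
ezWalks : (ℕ → ℕ) → ℕ → ℕ → ℕ → ℕ
ezWalks u zero    t zero    = indicator (multipleOf4 t) * u 0
ezWalks u zero    t (suc d) = u (suc d)
ezWalks u (suc l) t zero    =
  indicator (multipleOf4 t) * (ezWalks u l (suc t) 1 + ezWalks u l (suc t) 1)
ezWalks u (suc l) t (suc d) = ezWalks u l (suc t) (2 + d) + ezWalks u l (suc t) d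

ezWalks-firstHit : ∀ u l t d →
  ezWalks u l t d ≡ avoiding u l d + diagSum l (λ k j → firstHit k d * ezWalks u j (t + k) 0)
ezWalks-firstHit u zero    t zero    =
  sym (trans (*-identityˡ _) (cong (λ s → ezWalks u zero s 0) (+-identityʳ t)))
ezWalks-firstHit u (suc l) t zero    = sym (begin
  0 + (1 * ezWalks u (suc l) (t + 0) 0 + diagSum l (λ _ _ → 0))
    ≡⟨ cong₂ _+_ (*-identityˡ _) (diagSum-0 l) ⟩
  ezWalks u (suc l) (t + 0) 0 + 0
    ≡⟨ +-identityʳ _ ⟩
  ezWalks u (suc l) (t + 0) 0
    ≡⟨ cong (λ s → ezWalks u (suc l) s 0) (+-identityʳ t) ⟩
  ezWalks u (suc l) t 0 ∎)
ezWalks-firstHit u zero    t (suc d) = sym (+-identityʳ _)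
ezWalks-firstHit u (suc l) t (suc d) = begin
  W (2 + d) + W d
    ≡⟨ cong₂ _+_ (ezWalks-firstHit u l (suc t) (2 + d)) (ezWalks-firstHit u l (suc t) d) ⟩
  (avoiding u l (2 + d) + S (2 + d)) + (avoiding u l d + S d)
    ≡⟨ interchange (avoiding u l (2 + d)) (S (2 + d)) (avoiding u l d) (S d) ⟩
  avoiding u (suc l) (suc d) + (S (2 + d) + S d)
    ≡⟨ cong (avoiding u (suc l) (suc d) +_) (diagSum-+ l _ _) ⟨
  avoiding u (suc l) (suc d) + diagSum l (λ k j → firstHit k (2 + d) * Z k j + firstHit k d * Z k j)
    ≡⟨ cong (avoiding u (suc l) (suc d) +_) (diagSum-cong l (λ k j →
         trans (sym (*-distribʳ-+ (Z k j) (firstHit k (2 + d)) (firstHit k d)))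
               (cong (λ s → firstHit (suc k) (suc d) * ezWalks u j s 0) (sym (+-suc t k))))) ⟩
  avoiding u (suc l) (suc d)
    + diagSum l (λ k j → firstHit (suc k) (suc d) * ezWalks u j (t + suc k) 0) ∎
  where
  W : ℕ → ℕ
  W = ezWalks u l (suc t)
  Z : ℕ → ℕ → ℕ
  Z k j = ezWalks u j (suc t + k) 0
  S : ℕ → ℕ
  S e = diagSum l (λ k j → firstHit k e * Z k j)

ezWalks-+4 : ∀ u l t d → ezWalks u l (4 + t) d ≡ ezWalks u l t d
ezWalks-+4 u zero    t zero    = refl
ezWalks-+4 u zero    t (suc d) = refl
ezWalks-+4 u (suc l) t zero    =
  cong (λ w → indicator (multipleOf4 t) * (w + w)) (ezWalks-+4 u l (suc t) 1)
ezWalks-+4 u (suc l) t (suc d) =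
  cong₂ _+_ (ezWalks-+4 u l (suc t) (2 + d)) (ezWalks-+4 u l (suc t) d)

ezWalks-quadruple : ∀ u l i → ezWalks u l (quadruple i) 0 ≡ ezWalks u l 0 0
ezWalks-quadruple u l zero    = refl
ezWalks-quadruple u l (suc i) = trans (ezWalks-+4 u l (quadruple i) 0) (ezWalks-quadruple u l i)

ezWalks-misaligned : ∀ u l t → multipleOf4 t ≡ false → ezWalks u l t 0 ≡ 0
ezWalks-misaligned u zero    t t≢0 rewrite t≢0 = refl
ezWalks-misaligned u (suc l) t t≢0 rewrite t≢0 = refl

diagSum-3+quadruple : ∀ n F → (∀ k j → multipleOf4 (suc k) ≡ false → F k j ≡ 0) →
  diagSum (3 + quadruple n) F ≡ diagSum n (λ i j → F (3 + quadruple i) (quadruple j))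
diagSum-3+quadruple n F vanish
  rewrite vanish 0 (3 + quadruple n) refl
        | vanish 1 (2 + quadruple n) refl
        | vanish 2 (1 + quadruple n) refl
  with n
... | zero  = refl
... | suc m = cong (F 3 (quadruple (suc m)) +_)
                (diagSum-3+quadruple m (λ k j → F (4 + k) j) (λ k j → vanish (4 + k) j))

diagSum-quadruple : ∀ n F → (∀ k j → multipleOf4 (suc k) ≡ false → F k j ≡ 0) →
  diagSum (quadruple (suc n)) F ≡ diagSum n (λ i j → F (3 + quadruple i) (suc (quadruple j)))
diagSum-quadruple n F vanish = begin
  diagSum (suc (3 + quadruple n)) F
    ≡⟨ diagSum-last (3 + quadruple n) F ⟩
  diagSum (3 + quadruple n) (λ k j → F k (suc j)) + F (quadruple (suc n)) 0
    ≡⟨ cong (diagSum (3 + quadruple n) (λ k j → F k (suc j)) +_)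
            (vanish (quadruple (suc n)) 0 (multipleOf4-suc-quadruple (suc n))) ⟩
  diagSum (3 + quadruple n) (λ k j → F k (suc j)) + 0
    ≡⟨ +-identityʳ _ ⟩
  diagSum (3 + quadruple n) (λ k j → F k (suc j))
    ≡⟨ diagSum-3+quadruple n (λ k j → F k (suc j)) (λ k j → vanish k (suc j)) ⟩
  diagSum n (λ i j → F (3 + quadruple i) (suc (quadruple j))) ∎

firstReturn : ℕ → ℕ
firstReturn zero    = 0
firstReturn (suc k) = 2 * firstHit k 1

firstReturn4 : ℕ → ℕ
firstReturn4 i = firstReturn (quadruple i)

neverReturning : ℕ → ℕ
neverReturning zero    = 1
neverReturning (suc l) = 2 * escape l

neverReturning4 : ℕ → ℕ
neverReturning4 n = neverReturning (quadruple n)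

dyck4 : ℕ → ℕ
dyck4 n = dyck (quadruple n)

ezWalks-from-axis : ∀ u l → ezWalks u (suc l) 0 0 ≡
  2 * avoiding u l 1 + diagSum l (λ k j → firstReturn (suc k) * ezWalks u j (suc k) 0)
ezWalks-from-axis u l = begin
  W + W + 0                                   ≡⟨ +-identityʳ (W + W) ⟩
  W + W                                       ≡⟨ cong (W +_) (+-identityʳ W) ⟨
  2 * W                                       ≡⟨ cong (2 *_) (ezWalks-firstHit u l 1 1) ⟩
  2 * (avoiding u l 1 + diagSum l G)          ≡⟨ *-distribˡ-+ 2 (avoiding u l 1) (diagSum l G) ⟩
  2 * avoiding u l 1 + 2 * diagSum l G        ≡⟨ cong (2 * avoiding u l 1 +_) (diagSum-*ˡ l 2 G) ⟨
  2 * avoiding u l 1 + diagSum l (λ k j → 2 * G k j)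
    ≡⟨ cong (2 * avoiding u l 1 +_) (diagSum-cong l (λ k j → *-assoc 2 (firstHit k 1) _)) ⟨
  2 * avoiding u l 1 + diagSum l (λ k j → firstReturn (suc k) * ezWalks u j (suc k) 0) ∎
  where
  W = ezWalks u l 1 1
  G : ℕ → ℕ → ℕ
  G k j = firstHit k 1 * ezWalks u j (suc k) 0

return-misaligned : ∀ u k j → multipleOf4 (suc k) ≡ false →
  firstReturn (suc k) * ezWalks u j (suc k) 0 ≡ 0
return-misaligned u k j k+1≢0 =
  trans (cong (firstReturn (suc k) *_) (ezWalks-misaligned u j (suc k) k+1≢0)) (*-zeroʳ (firstReturn (suc k)))

ezCount : ℕ → ℕ
ezCount n = ezWalks (λ _ → 1) (quadruple n) 0 0

ezCount±1 : ℕ → ℕ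
ezCount±1 n = ezWalks atOne (suc (quadruple n)) 0 0

ezCount-renewal : ∀ n → ezCount n ≡ neverReturning4 n + (firstReturn4 ⋆ ezCount) n
ezCount-renewal zero    = refl
ezCount-renewal (suc n) = begin
  ezWalks u (suc (3 + quadruple n)) 0 0
    ≡⟨ ezWalks-from-axis u (3 + quadruple n) ⟩
  T + diagSum (3 + quadruple n) (λ k j → firstReturn (suc k) * ezWalks u j (suc k) 0)
    ≡⟨ cong (T +_) (diagSum-3+quadruple n _ (return-misaligned u)) ⟩
  T + diagSum n (λ i j → firstReturn4 (suc i) * ezWalks u (quadruple j) (quadruple (suc i)) 0)
    ≡⟨ cong (T +_) (diagSum-cong n (λ i j →
         cong (firstReturn4 (suc i) *_) (ezWalks-quadruple u (quadruple j) (suc i)))) ⟩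
  T + (firstReturn4 ⋆ ezCount) (suc n) ∎
  where
  u : ℕ → ℕ
  u _ = 1
  T = neverReturning4 (suc n)

ezCount±1-renewal : ∀ n → ezCount±1 n ≡ 2 * dyck4 n + (firstReturn4 ⋆ ezCount±1) n
ezCount±1-renewal zero    = refl
ezCount±1-renewal (suc n) = begin
  ezWalks atOne (suc (quadruple (suc n))) 0 0
    ≡⟨ ezWalks-from-axis atOne (quadruple (suc n)) ⟩
  T + diagSum (quadruple (suc n)) (λ k j → firstReturn (suc k) * ezWalks atOne j (suc k) 0)
    ≡⟨ cong (T +_) (diagSum-quadruple n _ (return-misaligned atOne)) ⟩
  T + diagSum n (λ i j → firstReturn4 (suc i) * ezWalks atOne (suc (quadruple j)) (quadruple (suc i)) 0)
    ≡⟨ cong (T +_) (diagSum-cong n (λ i j →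
         cong (firstReturn4 (suc i) *_) (ezWalks-quadruple atOne (suc (quadruple j)) (suc i)))) ⟩
  T + (firstReturn4 ⋆ ezCount±1) (suc n) ∎
  where
  T = 2 * dyck4 (suc n)

dyck-renewal : ∀ n → dyck4 n ≡ δ n + (firstReturn4 ⋆ dyck4) n
dyck-renewal zero    = refl
dyck-renewal (suc n) = begin
  dyck (2 + double (suc (double n)))
    ≡⟨ dyck-suc-suc (double (suc (double n))) ⟩
  (dyck ⋆ dyck) (double (suc (double n)))
    ≡⟨ diagSum-double (suc (double n)) (λ k j → dyck k * dyck j)
                      (λ k j → cong (_* dyck j) (dyck-odd k)) ⟩
  diagSum (suc (double n)) (λ k j → c k * c j)
    ≡⟨ diagSum-suc-double n (λ k j → c k * c j) ⟩
  diagSum n (λ k j → c (double k) * c (suc (double j))) + Y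
    ≡⟨ cong (_+ Y) (trans (diagSum-swap n _)
                          (diagSum-cong n (λ k j → *-comm (c (double j)) (c (suc (double k)))))) ⟩
  Y + Y
    ≡⟨ cong (Y +_) (+-identityʳ Y) ⟨
  2 * Y
    ≡⟨ diagSum-*ˡ n 2 _ ⟨
  diagSum n (λ k j → 2 * (c (suc (double k)) * c (double j)))
    ≡⟨ diagSum-cong n (λ k j →
         trans (sym (*-assoc 2 (c (suc (double k))) (c (double j))))
               (cong (λ h → 2 * h * c (double j)) (sym (firstHit-suc (2 + quadruple k) 1)))) ⟩
  (firstReturn4 ⋆ dyck4) (suc n) ∎
  where
  c : ℕ → ℕ
  c k = dyck (double k)
  Y = diagSum n (λ k j → c (suc (double k)) * c (double j))

ezCount≡dyck4⋆neverReturning4 : ∀ n → ezCount n ≡ (dyck4 ⋆ neverReturning4) n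
ezCount≡dyck4⋆neverReturning4 = renewal-unique firstReturn4 neverReturning4 refl ezCount-renewal
  (renewal-solution firstReturn4 neverReturning4 dyck4 dyck-renewal)

ezCount±1≡2*dyck4⋆dyck4 : ∀ n → ezCount±1 n ≡ 2 * (dyck4 ⋆ dyck4) n
ezCount±1≡2*dyck4⋆dyck4 n = trans
  (renewal-unique firstReturn4 T refl ezCount±1-renewal (renewal-solution firstReturn4 T dyck4 dyck-renewal) n)
  (⋆-*ʳ n 2 dyck4 dyck4)
  where
  T : ℕ → ℕ
  T m = 2 * dyck4 m

neverReturning4≡binom : ∀ n → neverReturning4 n ≡ binom (quadruple n) (double n)
neverReturning4≡binom zero    = refl
neverReturning4≡binom (suc n) = begin
  2 * escape (suc (double m))
    ≡⟨ cong (escape (suc (double m)) +_) (+-identityʳ _) ⟩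
  escape (suc (double m)) + escape (suc (double m))
    ≡⟨ cong₂ _+_ (escape-suc-double m) (trans (escape-suc-double m) (binom-sym-double 1 m)) ⟩
  binom (suc (double m)) m + binom (suc (double m)) (suc m) ∎
  where m = suc (double n)

dyck4≡Cat : ∀ i → dyck4 i ≡ Cat (2 * i)
dyck4≡Cat i = trans (sym (Cat≡dyck (double i))) (cong Cat (double≡2* i))

neverReturning4≡Bin : ∀ j → neverReturning4 j ≡ Bin (2 * j)
neverReturning4≡Bin j = begin
  neverReturning4 j                     ≡⟨ neverReturning4≡binom j ⟩
  binom (quadruple j) (double j)        ≡⟨ binom≡C (quadruple j) (double j) ⟩
  double (double j) C double j          ≡⟨ cong₂ (λ a b → a C b) (double≡2* (double j)) (double≡2* j) ⟩
  2 * double j C (2 * j)                ≡⟨ cong (λ a → 2 * a C (2 * j)) (double≡2* j) ⟩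
  2 * (2 * j) C (2 * j)                 ∎

-- Paths as lists of steps

up : ℤ → ℤ
up +0            = +[1+ 0 ]
up +[1+ n ]      = +[1+ suc n ]
up -[1+ zero ]   = +0
up -[1+ suc n ]  = -[1+ n ]

down : ℤ → ℤ
down +0          = -[1+ 0 ]
down +[1+ n ]    = ℤ.+ n
down -[1+ n ]    = -[1+ suc n ]

move : Bool → ℤ → ℤ
move true  = up
move false = down

move≡+step : ∀ s h → move s h ≡ h ℤ.+ step s
move≡+step true  +0              = refl
move≡+step true  +[1+ n ]        = cong +[1+_] (+-comm 1 n)
move≡+step true  -[1+ zero ]     = refl
move≡+step true  -[1+ suc n ]    = refl
move≡+step false +0              = refl
move≡+step false +[1+ n ]        = refl
move≡+step false -[1+ n ]        = cong (λ m → -[1+ suc m ]) (sym (+-identityʳ n))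

endpoint : ℤ → Path → ℤ
endpoint h []      = h
endpoint h (s ∷ p) = endpoint (move s h) p

endpoint≡+height : ∀ h p → endpoint h p ≡ h ℤ.+ height p
endpoint≡+height h []      = sym (ℤ.+-identityʳ h)
endpoint≡+height h (s ∷ p) = begin
  endpoint (move s h) p             ≡⟨ endpoint≡+height (move s h) p ⟩
  move s h ℤ.+ height p             ≡⟨ cong (ℤ._+ height p) (move≡+step s h) ⟩
  h ℤ.+ step s ℤ.+ height p         ≡⟨ ℤ.+-assoc h (step s) (height p) ⟩
  h ℤ.+ height (s ∷ p)              ∎

endpoint-origin : ∀ p → endpoint +0 p ≡ height p
endpoint-origin p = trans (endpoint≡+height +0 p) (ℤ.+-identityˡ (height p))

allowed : ℕ → ℤ → Bool
allowed t +0        = multipleOf4 t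
allowed t +[1+ _ ]  = true
allowed t -[1+ _ ]  = true

zerosAligned : ℕ → ℤ → Path → Bool
zerosAligned t h []      = allowed t h
zerosAligned t h (s ∷ p) = allowed t h ∧ zerosAligned (suc t) (move s h) p

multipleOf4-sound : ∀ t → multipleOf4 t ≡ true → 4 ∣ t
multipleOf4-sound zero                      _  = divides 0 refl
multipleOf4-sound (suc (suc (suc (suc t)))) eq = ∣m∣n⇒∣m+n (∣-refl {4}) (multipleOf4-sound t eq)

multipleOf4-complete : ∀ t → 4 ∣ t → multipleOf4 t ≡ true
multipleOf4-complete zero                      _   = refl
multipleOf4-complete (suc zero)                4∣t with s≤s () ← ∣⇒≤ 4∣t
multipleOf4-complete (suc (suc zero))          4∣t with s≤s (s≤s ()) ← ∣⇒≤ 4∣t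
multipleOf4-complete (suc (suc (suc zero)))    4∣t with s≤s (s≤s (s≤s ())) ← ∣⇒≤ 4∣t
multipleOf4-complete (suc (suc (suc (suc t)))) 4∣t =
  multipleOf4-complete t (∣m+n∣m⇒∣n 4∣t (∣-refl {4}))

allowed-sound : ∀ t h → allowed t h ≡ true → h ≡ +0 → 4 ∣ t
allowed-sound t +0 eq refl = multipleOf4-sound t eq

allowed-complete : ∀ t h → (h ≡ +0 → 4 ∣ t) → allowed t h ≡ true
allowed-complete t +0       at-zero = multipleOf4-complete t (at-zero refl)
allowed-complete t +[1+ _ ] _       = refl
allowed-complete t -[1+ _ ] _       = refl

ZerosAligned : ℕ → ℤ → Path → Set
ZerosAligned t h p = ∀ k → k ≤ length p → endpoint h (take k p) ≡ +0 → 4 ∣ t + k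

zerosAligned-sound : ∀ t h p → zerosAligned t h p ≡ true → ZerosAligned t h p
zerosAligned-sound t h []      eq zero    _       hit =
  subst (4 ∣_) (sym (+-identityʳ t)) (allowed-sound t h eq hit)
zerosAligned-sound t h (s ∷ p) eq k k≤ hit with allowed t h in allowed≡
zerosAligned-sound t h (s ∷ p) eq zero    _        hit | true =
  subst (4 ∣_) (sym (+-identityʳ t)) (allowed-sound t h allowed≡ hit)
zerosAligned-sound t h (s ∷ p) eq (suc k) (s≤s k≤) hit | true =
  subst (4 ∣_) (sym (+-suc t k)) (zerosAligned-sound (suc t) (move s h) p eq k k≤ hit)

zerosAligned-complete : ∀ t h p → ZerosAligned t h p → zerosAligned t h p ≡ true
zerosAligned-complete t h p aligned
  with allowed-complete t h (λ hit → subst (4 ∣_) (+-identityʳ t) (aligned 0 z≤n hit))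
zerosAligned-complete t h []      aligned | allowed≡true = allowed≡true
zerosAligned-complete t h (s ∷ p) aligned | allowed≡true rewrite allowed≡true =
  zerosAligned-complete (suc t) (move s h) p
    (λ k k≤ hit → subst (4 ∣_) (+-suc t k) (aligned (suc k) (s≤s k≤) hit))

does-evenZeroed? : ∀ p → does (evenZeroed? p) ≡ zerosAligned 0 +0 p
does-evenZeroed? p with zerosAligned 0 +0 p in eq
... | true  = dec-true (evenZeroed? p) (applyUpTo⁺₁ id (suc (length p)) (λ {k} k< hit →
                zerosAligned-sound 0 +0 p eq k (≤-pred k<) (trans (endpoint-origin (take k p)) hit)))
... | false = dec-false (evenZeroed? p) (λ ez → contradiction (trans (sym (aligned ez)) eq) λ ())
  where
  aligned : EvenZeroed p → zerosAligned 0 +0 p ≡ true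
  aligned ez = zerosAligned-complete 0 +0 p (λ k k≤ hit →
    applyUpTo⁻ id (suc (length p)) ez (s≤s k≤) (trans (sym (endpoint-origin (take k p))) hit))

pathWeight : (ℤ → ℕ) → ℕ → ℤ → Path → ℕ
pathWeight w t h p = indicator (zerosAligned t h p) * w (endpoint h p)

-- ezWalks on signed heights, weighted by a function of the signed final height
ezSum : (ℤ → ℕ) → ℕ → ℕ → ℤ → ℕ
ezSum w zero    t h = indicator (allowed t h) * w h
ezSum w (suc l) t h =
  indicator (allowed t h) * (ezSum w l (suc t) (up h) + ezSum w l (suc t) (down h))

pathWeight-∷ : ∀ w t h s p →
  pathWeight w t h (s ∷ p) ≡ indicator (allowed t h) * pathWeight w (suc t) (move s h) p
pathWeight-∷ w t h s p with allowed t h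
... | true  = sym (+-identityʳ _)
... | false = refl

sum-map-*ˡ : ∀ {A : Set} a (f : A → ℕ) xs → sum (map (λ x → a * f x) xs) ≡ a * sum (map f xs)
sum-map-*ˡ a f []       = sym (*-zeroʳ a)
sum-map-*ˡ a f (x ∷ xs) =
  trans (cong (a * f x +_) (sum-map-*ˡ a f xs)) (sym (*-distribˡ-+ a (f x) _))

sum-allPaths-suc : ∀ (f : Path → ℕ) l →
  sum (map f (allPaths (suc l)))
    ≡ sum (map (λ p → f (true ∷ p)) (allPaths l)) + sum (map (λ p → f (false ∷ p)) (allPaths l))
sum-allPaths-suc f l = begin
  sum (map f (map (true ∷_) A ++ map (false ∷_) A))
    ≡⟨ cong sum (map-++ f (map (true ∷_) A) _) ⟩
  sum (map f (map (true ∷_) A) ++ map f (map (false ∷_) A))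
    ≡⟨ sum-++ (map f (map (true ∷_) A)) _ ⟩
  sum (map f (map (true ∷_) A)) + sum (map f (map (false ∷_) A))
    ≡⟨ cong₂ _+_ (cong sum (map-∘ A)) (cong sum (map-∘ A)) ⟨
  sum (map (λ p → f (true ∷ p)) A) + sum (map (λ p → f (false ∷ p)) A) ∎
  where A = allPaths l

sum-pathWeight : ∀ w l t h → sum (map (pathWeight w t h) (allPaths l)) ≡ ezSum w l t h
sum-pathWeight w zero    t h = +-identityʳ _
sum-pathWeight w (suc l) t h = begin
  sum (map (pathWeight w t h) (allPaths (suc l)))
    ≡⟨ sum-allPaths-suc (pathWeight w t h) l ⟩
  sum (map (λ p → pathWeight w t h (true ∷ p)) A) + sum (map (λ p → pathWeight w t h (false ∷ p)) A)
    ≡⟨ cong₂ _+_ (cong sum (map-cong (pathWeight-∷ w t h true) A))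
                 (cong sum (map-cong (pathWeight-∷ w t h false) A)) ⟩
  sum (map (λ p → a * W↑ p) A) + sum (map (λ p → a * W↓ p) A)
    ≡⟨ cong₂ _+_ (sum-map-*ˡ a W↑ A) (sum-map-*ˡ a W↓ A) ⟩
  a * sum (map W↑ A) + a * sum (map W↓ A)
    ≡⟨ *-distribˡ-+ a _ _ ⟨
  a * (sum (map W↑ A) + sum (map W↓ A))
    ≡⟨ cong (a *_) (cong₂ _+_ (sum-pathWeight w l (suc t) (up h)) (sum-pathWeight w l (suc t) (down h))) ⟩
  ezSum w (suc l) t h ∎
  where
  A = allPaths l
  a = indicator (allowed t h)
  W↑ W↓ : Path → ℕ
  W↑ = pathWeight w (suc t) (up h)
  W↓ = pathWeight w (suc t) (down h)

length-filter≡sum : ∀ {A : Set} {P : A → Set} (P? : Decidable P) xs →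
  length (filter P? xs) ≡ sum (map (λ x → indicator (does (P? x))) xs)
length-filter≡sum P? []       = refl
length-filter≡sum P? (x ∷ xs) with does (P? x)
... | true  = cong suc (length-filter≡sum P? xs)
... | false = length-filter≡sum P? xs

atPlusOne : ℤ → ℕ
atPlusOne h = indicator (does (h ℤ.≟ +[1+ 0 ]))

countEZ≡ezSum : ∀ l → countEZ l ≡ ezSum (λ _ → 1) l 0 +0
countEZ≡ezSum l = begin
  length (filter evenZeroed? (allPaths l))                         ≡⟨ length-filter≡sum evenZeroed? (allPaths l) ⟩
  sum (map (λ p → indicator (does (evenZeroed? p))) (allPaths l))  ≡⟨ cong sum (map-cong weight (allPaths l)) ⟩
  sum (map (pathWeight (λ _ → 1) 0 +0) (allPaths l))               ≡⟨ sum-pathWeight (λ _ → 1) l 0 +0 ⟩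
  ezSum (λ _ → 1) l 0 +0                                           ∎
  where
  weight : ∀ p → indicator (does (evenZeroed? p)) ≡ pathWeight (λ _ → 1) 0 +0 p
  weight p = trans (cong indicator (does-evenZeroed? p)) (sym (*-identityʳ _))

countEZ1≡ezSum : ∀ l → countEZ1 l ≡ ezSum atPlusOne l 0 +0
countEZ1≡ezSum l = begin
  countEZ1 l                                                    ≡⟨ length-filter≡sum _ (allPaths l) ⟩
  sum (map (λ p → indicator (does (evenZeroed? p) ∧ does (height p ℤ.≟ +[1+ 0 ]))) (allPaths l))
                                                                ≡⟨ cong sum (map-cong weight (allPaths l)) ⟩
  sum (map (pathWeight atPlusOne 0 +0) (allPaths l))            ≡⟨ sum-pathWeight atPlusOne l 0 +0 ⟩
  ezSum atPlusOne l 0 +0                                        ∎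
  where
  weight : ∀ p →
    indicator (does (evenZeroed? p) ∧ does (height p ℤ.≟ +[1+ 0 ])) ≡ pathWeight atPlusOne 0 +0 p
  weight p rewrite does-evenZeroed? p with zerosAligned 0 +0 p
  ... | true  = trans (cong atPlusOne (sym (endpoint-origin p))) (sym (+-identityʳ _))
  ... | false = refl

∣up-[1+n]∣ : ∀ n → ∣ up -[1+ n ] ∣ ≡ n
∣up-[1+n]∣ zero    = refl
∣up-[1+n]∣ (suc n) = refl

ezSum-∣∣ : ∀ (w : ℤ → ℕ) (u : ℕ → ℕ) → (∀ h → w h ≡ u ∣ h ∣) →
  ∀ l t h → ezSum w l t h ≡ ezWalks u l t ∣ h ∣
ezSum-∣∣ w u w≡u∣∣ zero    t +0        = cong (indicator (multipleOf4 t) *_) (w≡u∣∣ +0)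
ezSum-∣∣ w u w≡u∣∣ zero    t +[1+ n ]  = trans (+-identityʳ _) (w≡u∣∣ +[1+ n ])
ezSum-∣∣ w u w≡u∣∣ zero    t -[1+ n ]  = trans (+-identityʳ _) (w≡u∣∣ -[1+ n ])
ezSum-∣∣ w u w≡u∣∣ (suc l) t +0        = cong (indicator (multipleOf4 t) *_)
  (cong₂ _+_ (ezSum-∣∣ w u w≡u∣∣ l (suc t) +[1+ 0 ]) (ezSum-∣∣ w u w≡u∣∣ l (suc t) -[1+ 0 ]))
ezSum-∣∣ w u w≡u∣∣ (suc l) t +[1+ n ]  = trans (*-identityˡ _)
  (cong₂ _+_ (ezSum-∣∣ w u w≡u∣∣ l (suc t) +[1+ suc n ]) (ezSum-∣∣ w u w≡u∣∣ l (suc t) (ℤ.+ n)))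
ezSum-∣∣ w u w≡u∣∣ (suc l) t -[1+ n ]  = begin
  1 * (ezSum w l (suc t) (up -[1+ n ]) + ezSum w l (suc t) -[1+ suc n ])
    ≡⟨ *-identityˡ _ ⟩
  ezSum w l (suc t) (up -[1+ n ]) + ezSum w l (suc t) -[1+ suc n ]
    ≡⟨ cong₂ _+_ (trans (ezSum-∣∣ w u w≡u∣∣ l (suc t) (up -[1+ n ]))
                        (cong (ezWalks u l (suc t)) (∣up-[1+n]∣ n)))
                 (ezSum-∣∣ w u w≡u∣∣ l (suc t) -[1+ suc n ]) ⟩
  ezWalks u l (suc t) n + ezWalks u l (suc t) (2 + n)
    ≡⟨ +-comm (ezWalks u l (suc t) n) _ ⟩
  ezWalks u (suc l) t (suc n) ∎

allowed-reflect : ∀ t h → allowed t (ℤ.- h) ≡ allowed t h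
allowed-reflect t +0       = refl
allowed-reflect t +[1+ n ] = refl
allowed-reflect t -[1+ n ] = refl

up-reflect : ∀ h → up (ℤ.- h) ≡ ℤ.- down h
up-reflect +0             = refl
up-reflect +[1+ zero ]    = refl
up-reflect +[1+ suc n ]   = refl
up-reflect -[1+ n ]       = refl

down-reflect : ∀ h → down (ℤ.- h) ≡ ℤ.- up h
down-reflect +0           = refl
down-reflect +[1+ n ]     = refl
down-reflect -[1+ zero ]  = refl
down-reflect -[1+ suc n ] = refl

ezSum-reflect : ∀ w l t h → ezSum w l t (ℤ.- h) ≡ ezSum (λ x → w (ℤ.- x)) l t h
ezSum-reflect w zero    t +0       = refl
ezSum-reflect w zero    t +[1+ n ] = refl
ezSum-reflect w zero    t -[1+ n ] = refl
ezSum-reflect w (suc l) t h        = cong₂ _*_ (cong indicator (allowed-reflect t h)) (begin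
  ezSum w l (suc t) (up (ℤ.- h)) + ezSum w l (suc t) (down (ℤ.- h))
    ≡⟨ cong₂ _+_ (cong (ezSum w l (suc t)) (up-reflect h))
                 (cong (ezSum w l (suc t)) (down-reflect h)) ⟩
  ezSum w l (suc t) (ℤ.- down h) + ezSum w l (suc t) (ℤ.- up h)
    ≡⟨ cong₂ _+_ (ezSum-reflect w l (suc t) (down h)) (ezSum-reflect w l (suc t) (up h)) ⟩
  ezSum w′ l (suc t) (down h) + ezSum w′ l (suc t) (up h)
    ≡⟨ +-comm (ezSum w′ l (suc t) (down h)) _ ⟩
  ezSum w′ l (suc t) (up h) + ezSum w′ l (suc t) (down h) ∎)
  where
  w′ : ℤ → ℕ
  w′ x = w (ℤ.- x)

ezSum-+ : ∀ (w w′ : ℤ → ℕ) l t h →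
  ezSum (λ x → w x + w′ x) l t h ≡ ezSum w l t h + ezSum w′ l t h
ezSum-+ w w′ zero    t h = *-distribˡ-+ (indicator (allowed t h)) (w h) (w′ h)
ezSum-+ w w′ (suc l) t h = trans (cong (indicator (allowed t h) *_)
    (trans (cong₂ _+_ (ezSum-+ w w′ l (suc t) (up h)) (ezSum-+ w w′ l (suc t) (down h)))
           (interchange (ezSum w l (suc t) (up h)) (ezSum w′ l (suc t) (up h)) (ezSum w l (suc t) (down h)) _)))
  (*-distribˡ-+ (indicator (allowed t h)) _ _)

atPlusOne-symmetrize : ∀ h → atPlusOne h + atPlusOne (ℤ.- h) ≡ atOne ∣ h ∣
atPlusOne-symmetrize +0              = refl
atPlusOne-symmetrize +[1+ zero ]     = refl
atPlusOne-symmetrize +[1+ suc n ]    = refl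
atPlusOne-symmetrize -[1+ zero ]     = refl
atPlusOne-symmetrize -[1+ suc n ]    = refl

countEZ-quadruple : ∀ n → countEZ (quadruple n) ≡ ezCount n
countEZ-quadruple n =
  trans (countEZ≡ezSum (quadruple n)) (ezSum-∣∣ (λ _ → 1) (λ _ → 1) (λ _ → refl) (quadruple n) 0 +0)

countEZ1-suc-quadruple : ∀ n → 2 * countEZ1 (suc (quadruple n)) ≡ ezCount±1 n
countEZ1-suc-quadruple n = begin
  2 * countEZ1 l                                  ≡⟨ cong (2 *_) (countEZ1≡ezSum l) ⟩
  2 * ezSum atPlusOne l 0 +0                      ≡⟨ cong (ezSum atPlusOne l 0 +0 +_) (+-identityʳ _) ⟩
  ezSum atPlusOne l 0 +0 + ezSum atPlusOne l 0 (ℤ.- +0)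
                                                  ≡⟨ cong (ezSum atPlusOne l 0 +0 +_) (ezSum-reflect atPlusOne l 0 +0) ⟩
  ezSum atPlusOne l 0 +0 + ezSum atMinusOne l 0 +0
                                                  ≡⟨ ezSum-+ atPlusOne atMinusOne l 0 +0 ⟨
  ezSum (λ x → atPlusOne x + atMinusOne x) l 0 +0 ≡⟨ ezSum-∣∣ _ atOne atPlusOne-symmetrize l 0 +0 ⟩
  ezWalks atOne l 0 0                             ∎
  where
  l = suc (quadruple n)
  atMinusOne : ℤ → ℕ
  atMinusOne x = atPlusOne (ℤ.- x)

lemma6 : (n : ℕ) →
    (countEZ (4 * n) ≡ convSum (λ i j → Cat (2 * i) * Bin (2 * j)) n)
    × (countEZ1 (4 * n + 1) ≡ convSum (λ i j → Cat (2 * i) * Cat (2 * j)) n)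
lemma6 n = part-a , part-b
  where
  part-a : countEZ (4 * n) ≡ convSum (λ i j → Cat (2 * i) * Bin (2 * j)) n
  part-a = begin
    countEZ (4 * n)                                ≡⟨ cong countEZ (quadruple≡4* n) ⟨
    countEZ (quadruple n)                          ≡⟨ countEZ-quadruple n ⟩
    ezCount n                                      ≡⟨ ezCount≡dyck4⋆neverReturning4 n ⟩
    (dyck4 ⋆ neverReturning4) n                    ≡⟨ ⋆-cong n dyck4≡Cat neverReturning4≡Bin ⟩
    diagSum n (λ i j → Cat (2 * i) * Bin (2 * j))  ≡⟨ convSum≡diagSum _ n ⟨
    convSum (λ i j → Cat (2 * i) * Bin (2 * j)) n  ∎
  part-b : countEZ1 (4 * n + 1) ≡ convSum (λ i j → Cat (2 * i) * Cat (2 * j)) n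
  part-b = *-cancelˡ-≡ _ _ 2 (begin
    2 * countEZ1 (4 * n + 1)
      ≡⟨ cong (λ l → 2 * countEZ1 l) (trans (+-comm (4 * n) 1) (cong suc (sym (quadruple≡4* n)))) ⟩
    2 * countEZ1 (suc (quadruple n))                   ≡⟨ countEZ1-suc-quadruple n ⟩
    ezCount±1 n                                        ≡⟨ ezCount±1≡2*dyck4⋆dyck4 n ⟩
    2 * (dyck4 ⋆ dyck4) n                              ≡⟨ cong (2 *_) (⋆-cong n dyck4≡Cat dyck4≡Cat) ⟩
    2 * diagSum n (λ i j → Cat (2 * i) * Cat (2 * j))  ≡⟨ cong (2 *_) (convSum≡diagSum _ n) ⟨
    2 * convSum (λ i j → Cat (2 * i) * Cat (2 * j)) n  ∎)
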